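{- Let $p$ be an odd prime. For all integers $u,v$ with $1\le u,v<\kappa_p$, $$\gamma_p\!\left(\frac{u}{v}\right)\equiv 0 \pmod p,$$ where $u/v$ denotes $u v^{ -1}\in\mathbb{F}_p$.
   Context: For an integer $k$ with $k\not\equiv 0 \pmod p$, the Fermat quotient $q_p(k)$ is the unique integer in $\{0,1,\dots,p-1\}$ with $k^{p-1}\equiv 1+q_p(k)\,p \pmod{p^2}$. Define $\kappa_p:=\min\{n>0 \mid q_p(n)\neq 0\}$. The Mirimanoff polynomial is $\gamma_p(t):=\sum_{j=1}^{p-1} \frac{t^j}{j}$, with coefficients in $\mathbb{F}_p$ (so $1/j$ is the inverse of $j$ modulo $p$). -}

module Defs where

open import Data.Nat using (ℕ; zero; suc; _+_; _*_; _∸_; _^_; _≤_; _<_)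
open import Data.Product using (∃)
open import Relation.Binary.PropositionalEquality using (_≡_)

sumFrom1 : ℕ → (ℕ → ℕ) → ℕ
sumFrom1 zero    f = 0
sumFrom1 (suc n) f = sumFrom1 n f + f (suc n)

≡1mod : (a m : ℕ) → Set
≡1mod a m = ∃ λ k → a ≡ 1 + k * m

FermatQuotientZero : (p n : ℕ) → Set
FermatQuotientZero p n = ≡1mod (n ^ (p ∸ 1)) (p * p)

-- m < κ_p  (κ_p = min{n>0 | q_p(n) ≠ 0}):
-- every n with 1 ≤ n ≤ m has q_p(n) = 0.
BelowKappa : (p m : ℕ) → Set
BelowKappa p m = ∀ n → 1 ≤ n → n ≤ m → FermatQuotientZero p n

IsInverseModOn : (p : ℕ) → (ℕ → ℕ) → Set
IsInverseModOn p inv = ∀ j → 1 ≤ j → j < p → ≡1mod (j * inv j) p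

-- A natural-number lift of γ_p(t) = Σ_{j=1}^{p-1} t^j / j,
-- where 1/j is represented by inv j; its residue mod p is γ_p(t mod p).
mirimanoff : (p : ℕ) → (inv : ℕ → ℕ) → (t : ℕ) → ℕ
mirimanoff p inv t = sumFrom1 (p ∸ 1) (λ j → (t ^ j) * inv j)

{-# OPTIONS --safe #-}
-- Write p = n + 1.  In the binomial expansion of (u − v)^p every inner coefficient satisfies
-- C(p, j) ≡ p · (−1)^(j−1) / j (mod p²), because j · C(p, j) = p · C(p − 1, j − 1) and
-- C(p − 1, j − 1) ≡ (−1)^(j−1) (mod p).  As p is odd, the inner part of the expansion is therefore
-- ≡ p · H (mod p²), where H = Σ_{j=1}^{p−1} u^j v^(p−j) / j = v^p γ_p(u/v).  On the other hand
-- z^p ≡ z (mod p²) whenever |z| < κ_p, which applies to u, −v and u − v, so the inner part,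
-- (u − v)^p + v^p − u^p, is ≡ 0 (mod p²).  Hence p ∣ H, and multiplying by w^p, where v w ≡ 1,
-- gives γ_p(u w) ≡ w^p H ≡ 0 (mod p).
module Submission where

open import Defs

module _ where
  open import Data.Nat.Base using (ℕ; zero; suc; _+_; _*_; _<_)
  open import Data.Nat.Properties
    using (*-comm; *-zeroʳ; *-distribˡ-+; +-assoc; *-identityʳ; +-identityʳ; <⇒≱)
  open import Data.Nat.Combinatorics using (_C_; nC1≡n) renaming (nCk+nC[k+1]≡[n+1]C[k+1] to pascal)
  open import Data.Nat.Divisibility using (_∣_; divides; ∣⇒≤)
  open import Data.Nat.Primality using (Prime; euclidsLemma)
  open import Data.Sum using (inj₁; inj₂)
  open import Relation.Nullary using (contradiction)
  open import Relation.Binary.PropositionalEquality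
    using (_≡_; refl; cong; cong₂; sym; trans; module ≡-Reasoning)

  [k+1]*[n+1]C[k+1]≡[n+1]*nCk : ∀ n k → suc k * (suc n C suc k) ≡ suc n * (n C k)
  [k+1]*[n+1]C[k+1]≡[n+1]*nCk zero    zero    = refl
  [k+1]*[n+1]C[k+1]≡[n+1]*nCk zero    (suc k) = *-zeroʳ (suc (suc k))
  [k+1]*[n+1]C[k+1]≡[n+1]*nCk (suc n) zero    =
    trans (+-identityʳ _) (trans (nC1≡n (suc (suc n))) (sym (*-identityʳ (suc (suc n)))))
  [k+1]*[n+1]C[k+1]≡[n+1]*nCk (suc n) (suc k) = begin
    suc (suc k) * (suc m C suc (suc k))
      ≡⟨ cong (suc (suc k) *_) (pascal m (suc k)) ⟨
    suc (suc k) * (m C suc k + m C suc (suc k))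
      ≡⟨ *-distribˡ-+ (suc (suc k)) (m C suc k) (m C suc (suc k)) ⟩
    m C suc k + suc k * (m C suc k) + suc (suc k) * (m C suc (suc k))
      ≡⟨ cong₂ (λ a b → m C suc k + a + b) ([k+1]*[n+1]C[k+1]≡[n+1]*nCk n k)
                                           ([k+1]*[n+1]C[k+1]≡[n+1]*nCk n (suc k)) ⟩
    m C suc k + m * (n C k) + m * (n C suc k)
      ≡⟨ +-assoc (m C suc k) (m * (n C k)) (m * (n C suc k)) ⟩
    m C suc k + (m * (n C k) + m * (n C suc k))
      ≡⟨ cong (m C suc k +_) (*-distribˡ-+ m (n C k) (n C suc k)) ⟨
    m C suc k + m * (n C k + n C suc k)
      ≡⟨ cong (λ c → m C suc k + m * c) (pascal n k) ⟩
    suc m * (m C suc k)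
      ∎
    where
    open ≡-Reasoning
    m : ℕ
    m = suc n

  p∣pCk : ∀ {p k} → Prime p → 0 < k → k < p → p ∣ p C k
  p∣pCk {suc n} {suc k} pr _ k<p with euclidsLemma (suc k) (suc n C suc k) pr
    (divides (n C k) (trans ([k+1]*[n+1]C[k+1]≡[n+1]*nCk n k) (*-comm (suc n) (n C k))))
  ... | inj₁ p∣k = contradiction (∣⇒≤ p∣k) (<⇒≱ k<p)
  ... | inj₂ p∣C = p∣C

module _ where
  open import Data.Nat.Base as ℕ using (ℕ; zero; suc; _∸_; _⊔_; s≤s; z≤n)
  import Data.Nat.Properties as ℕ
  import Data.Nat.Divisibility as ℕ
  open import Function.Base using (_∘_)
  open import Data.Product.Base using (_,_)
  open import Data.Sum.Base using (inj₁; inj₂)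
  open import Relation.Nullary using (¬_; contradiction)
  open import Data.Nat.Combinatorics using (_C_; nCn≡1) renaming (nCk+nC[k+1]≡[n+1]C[k+1] to pascal)
  open import Data.Nat.Primality using (Prime)
  open import Data.Fin.Base using (Fin; zero; suc; toℕ)
  open import Data.Fin.Properties using (toℕ-inject₁; toℕ-fromℕ; toℕ<n)
  open import Data.Integer.Base
    using (ℤ; NonZero; +_; +0; +[1+_]; -[1+_]; 0ℤ; 1ℤ; -1ℤ; ∣_∣; _+_; _-_; -_; _*_)
  open import Data.Integer.Properties
    using (+-*-semiring; +-*-commutativeSemiring; +-assoc; +-identityˡ; +-identityʳ; +-inverseʳ;
           *-identityˡ; *-identityʳ; *-zeroˡ; *-zeroʳ; *-comm; *-assoc; pos-+; pos-*; -1*i≡-i;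
           neg-involutive; suc-*; m-n≡m⊖n; ∣m⊝n∣≤m⊔n; ∣-i∣≡∣i∣)
  open import Data.Integer.Divisibility.Signed
    using (_∣_; divides; ∣-trans; ∣-reflexive; ∣ᵤ⇒∣; ∣m∣n⇒∣m+n; ∣m⇒∣-m; ∣n⇒∣m*n; ∣m⇒∣m*n;
           *-monoʳ-∣; *-cancelˡ-∣)
  open import Data.Integer.Tactic.RingSolver using (solve-∀)
  open import Algebra.Properties.Semiring.Exp +-*-semiring using (_^_; ^-homo-*)
  open import Algebra.Properties.CommutativeSemiring.Exp +-*-commutativeSemiring using (^-distrib-*)
  open import Algebra.Properties.Semiring.Mult +-*-semiring using (_×_)
  open import Algebra.Properties.Semiring.Sum +-*-semiring
    using (sum; sum-syntax; sum⁺-syntax; sum-cong-≗; sum-init-last; *-distribˡ-sum)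
  open import Algebra.Properties.CommutativeSemiring.Binomial +-*-commutativeSemiring using (theorem)
  open import Level using (0ℓ)
  open import Relation.Binary.Bundles using (Setoid)
  import Relation.Binary.Reasoning.Setoid as SetoidReasoning
  open import Relation.Binary.PropositionalEquality
    using (_≡_; refl; sym; trans; cong; cong₂; subst; module ≡-Reasoning)

  -- Congruences of integers

  -- A record rather than a definition, so that a, b and m can be inferred from a congruence proof.
  infix 4 _≡_mod_
  record _≡_mod_ (a b m : ℤ) : Set where
    constructor mod-∣
    field ∣-difference : m ∣ a - b

  mod-reflexive : ∀ {m a b} → a ≡ b → a ≡ b mod m
  mod-reflexive {m} {a} refl = mod-∣ (divides 0ℤ (trans (+-inverseʳ a) (sym (*-zeroˡ m))))

  mod-refl : ∀ {m a} → a ≡ a mod m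
  mod-refl = mod-reflexive refl

  mod-sym : ∀ {m a b} → a ≡ b mod m → b ≡ a mod m
  mod-sym {a = a} {b} (mod-∣ a≡b) =
    mod-∣ (∣-trans (∣m⇒∣-m a≡b) (∣-reflexive (-[a-b]≡b-a a b)))
    where
    -[a-b]≡b-a : ∀ a b → - (a - b) ≡ b - a
    -[a-b]≡b-a = solve-∀

  mod-trans : ∀ {m a b c} → a ≡ b mod m → b ≡ c mod m → a ≡ c mod m
  mod-trans {a = a} {b} {c} (mod-∣ a≡b) (mod-∣ b≡c) =
    mod-∣ (∣-trans (∣m∣n⇒∣m+n a≡b b≡c) (∣-reflexive ([a-b]+[b-c]≡a-c a b c)))
    where
    [a-b]+[b-c]≡a-c : ∀ a b c → a - b + (b - c) ≡ a - c
    [a-b]+[b-c]≡a-c = solve-∀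

  mod-setoid : ℤ → Setoid 0ℓ 0ℓ
  mod-setoid m = record
    { Carrier = ℤ
    ; _≈_ = _≡_mod m
    ; isEquivalence = record { refl = mod-refl ; sym = mod-sym ; trans = mod-trans }
    }

  module ≡-mod-Reasoning (m : ℤ) = SetoidReasoning (mod-setoid m)

  +-cong-mod : ∀ {m a b c d} → a ≡ b mod m → c ≡ d mod m → a + c ≡ b + d mod m
  +-cong-mod {a = a} {b} {c} {d} (mod-∣ a≡b) (mod-∣ c≡d) =
    mod-∣ (∣-trans (∣m∣n⇒∣m+n a≡b c≡d) (∣-reflexive ([a-b]+[c-d]≡[a+c]-[b+d] a b c d)))
    where
    [a-b]+[c-d]≡[a+c]-[b+d] : ∀ a b c d → a - b + (c - d) ≡ a + c - (b + d)
    [a-b]+[c-d]≡[a+c]-[b+d] = solve-∀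

  -‿cong-mod : ∀ {m a b} → a ≡ b mod m → - a ≡ - b mod m
  -‿cong-mod {a = a} {b} (mod-∣ a≡b) =
    mod-∣ (∣-trans (∣m⇒∣-m a≡b) (∣-reflexive (-[a-b]≡-a--b a b)))
    where
    -[a-b]≡-a--b : ∀ a b → - (a - b) ≡ - a - - b
    -[a-b]≡-a--b = solve-∀

  *-cong-mod : ∀ {m a b c d} → a ≡ b mod m → c ≡ d mod m → a * c ≡ b * d mod m
  *-cong-mod {a = a} {b} {c} {d} (mod-∣ a≡b) (mod-∣ c≡d) =
    mod-∣ (∣-trans (∣m∣n⇒∣m+n (∣m⇒∣m*n c a≡b) (∣n⇒∣m*n b c≡d))
                   (∣-reflexive ([a-b]c+b[c-d]≡ac-bd a b c d)))
    where
    [a-b]c+b[c-d]≡ac-bd : ∀ a b c d → (a - b) * c + b * (c - d) ≡ a * c - b * d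
    [a-b]c+b[c-d]≡ac-bd = solve-∀

  *-congˡ-mod : ∀ a {m c d} → c ≡ d mod m → a * c ≡ a * d mod m
  *-congˡ-mod a = *-cong-mod (mod-refl {a = a})

  *-congʳ-mod : ∀ c {m a b} → a ≡ b mod m → a * c ≡ b * c mod m
  *-congʳ-mod c a≡b = *-cong-mod a≡b (mod-refl {a = c})

  *-scale-mod : ∀ c {m a b} → a ≡ b mod m → c * a ≡ c * b mod c * m
  *-scale-mod c {a = a} {b} (mod-∣ a≡b) =
    mod-∣ (∣-trans (*-monoʳ-∣ c a≡b) (∣-reflexive (c[a-b]≡ca-cb c a b)))
    where
    c[a-b]≡ca-cb : ∀ c a b → c * (a - b) ≡ c * a - c * b
    c[a-b]≡ca-cb = solve-∀

  *-unscale-mod : ∀ c {m a b} .{{_ : NonZero c}} → c * a ≡ c * b mod c * m → a ≡ b mod m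
  *-unscale-mod c {a = a} {b} (mod-∣ ca≡cb) =
    mod-∣ (*-cancelˡ-∣ c (∣-trans ca≡cb (∣-reflexive (sym (c[a-b]≡ca-cb c a b)))))
    where
    c[a-b]≡ca-cb : ∀ c a b → c * (a - b) ≡ c * a - c * b
    c[a-b]≡ca-cb = solve-∀

  ∣⇒≡0-mod : ∀ {m a} → m ∣ a → a ≡ 0ℤ mod m
  ∣⇒≡0-mod {m} {a} m∣a = mod-∣ (subst (m ∣_) (sym (+-identityʳ a)) m∣a)

  ≡0-mod⇒∣ : ∀ {m a} → a ≡ 0ℤ mod m → m ∣ a
  ≡0-mod⇒∣ {m} {a} (mod-∣ m∣a) = subst (m ∣_) (+-identityʳ a) m∣a

  ∑-cong-mod : ∀ {m n} {f g : Fin n → ℤ} → (∀ k → f k ≡ g k mod m) → sum f ≡ sum g mod m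
  ∑-cong-mod {n = zero}  f≡g = mod-refl
  ∑-cong-mod {n = suc n} f≡g = +-cong-mod (f≡g zero) (∑-cong-mod (f≡g ∘ suc))

  ^≡1-mod : ∀ {m a} → a ≡ 1ℤ mod m → ∀ n → a ^ n ≡ 1ℤ mod m
  ^≡1-mod a≡1 zero    = mod-refl
  ^≡1-mod a≡1 (suc n) = *-cong-mod a≡1 (^≡1-mod a≡1 n)

  ≡1mod⇒≡1-mod : ∀ {a m} → ≡1mod a m → + a ≡ 1ℤ mod + m
  ≡1mod⇒≡1-mod {m = m} (q , refl) = mod-∣ (divides (+ q) (pos-* q m))

  pos-^ : ∀ m k → + (m ℕ.^ k) ≡ (+ m) ^ k
  pos-^ m zero    = refl
  pos-^ m (suc k) = trans (pos-* m (m ℕ.^ k)) (cong (λ e → + m * e) (pos-^ m k))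

  ×≡pos* : ∀ n x → n × x ≡ + n * x
  ×≡pos* zero    x = sym (*-zeroˡ x)
  ×≡pos* (suc n) x = trans (cong (λ y → x + y) (×≡pos* n x)) (sym (suc-* (+ n) x))

  ∑-init-last : ∀ n (f : ℕ → ℤ) →
    ∑[ k < suc n ] f (toℕ k) ≡ ∑[ k < n ] f (toℕ k) + f n
  ∑-init-last n f = trans (sum-init-last {n} (f ∘ toℕ))
    (cong₂ _+_ (sum-cong-≗ {n} (cong f ∘ toℕ-inject₁)) (cong f (toℕ-fromℕ n)))

  ∑-first-inner-last : ∀ n (f : ℕ → ℤ) →
    ∑[ k ≤ suc n ] f (toℕ k) ≡ f 0 + ∑[ k < n ] f (suc (toℕ k)) + f (suc n)
  ∑-first-inner-last n f =
    trans (cong (λ s → f 0 + s) (∑-init-last n (f ∘ suc))) (sym (+-assoc (f 0) _ _))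

  +sumFrom1 : ∀ n f → + sumFrom1 n f ≡ ∑[ k < n ] (+ f (suc (toℕ k)))
  +sumFrom1 zero    f = refl
  +sumFrom1 (suc n) f = begin
    + (sumFrom1 n f ℕ.+ f (suc n))               ≡⟨ pos-+ (sumFrom1 n f) (f (suc n)) ⟩
    + sumFrom1 n f + + f (suc n)                 ≡⟨ cong (_+ + f (suc n)) (+sumFrom1 n f) ⟩
    ∑[ k < n ] (+ f (suc (toℕ k))) + + f (suc n) ≡⟨ ∑-init-last n (λ j → + f (suc j)) ⟨
    ∑[ k < suc n ] (+ f (suc (toℕ k)))           ∎
    where open ≡-Reasoning

  binomial-theorem-inner : ∀ x y n → (x + y) ^ suc n ≡
    y ^ suc n + ∑[ k < n ] (+ (suc n C suc (toℕ k)) * (x ^ suc (toℕ k) * y ^ (n ∸ toℕ k)))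
              + x ^ suc n
  binomial-theorem-inner x y n = begin
    (x + y) ^ suc n
      ≡⟨ theorem (suc n) x y ⟩
    ∑[ k ≤ suc n ] ((suc n C toℕ k) × monomial (toℕ k))
      ≡⟨ sum-cong-≗ {suc (suc n)} (λ k → ×≡pos* (suc n C toℕ k) (monomial (toℕ k))) ⟩
    ∑[ k ≤ suc n ] term (toℕ k)
      ≡⟨ ∑-first-inner-last n term ⟩
    term 0 + inner + term (suc n)
      ≡⟨ cong₂ (λ a b → a + inner + b) first last ⟩
    y ^ suc n + inner + x ^ suc n
      ∎
    where
    open ≡-Reasoning
    monomial : ℕ → ℤ
    monomial j = x ^ j * y ^ (suc n ∸ j)
    term : ℕ → ℤ
    term j = + (suc n C j) * monomial j
    inner : ℤ
    inner = ∑[ k < n ] term (suc (toℕ k))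
    first : term 0 ≡ y ^ suc n
    first = trans (*-identityˡ _) (*-identityˡ _)
    last : term (suc n) ≡ x ^ suc n
    last rewrite nCn≡1 (suc n) | ℕ.n∸n≡0 n = trans (*-identityˡ _) (*-identityʳ _)

  2∤1+n⇒-1^n≡1 : ∀ n → ¬ (2 ℕ.∣ suc n) → -1ℤ ^ n ≡ 1ℤ
  2∤1+n⇒-1^n≡1 zero          _     = refl
  2∤1+n⇒-1^n≡1 (suc zero)    2∤2   = contradiction ℕ.∣-refl 2∤2
  2∤1+n⇒-1^n≡1 (suc (suc n)) 2∤n+3 = begin
    -1ℤ * (-1ℤ * -1ℤ ^ n)  ≡⟨ cong (-1ℤ *_) (-1*i≡-i _) ⟩
    -1ℤ * - (-1ℤ ^ n)      ≡⟨ -1*i≡-i _ ⟩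
    - - (-1ℤ ^ n)          ≡⟨ neg-involutive _ ⟩
    -1ℤ ^ n                ≡⟨ 2∤1+n⇒-1^n≡1 n (2∤n+3 ∘ ℕ.∣m∣n⇒∣m+n ℕ.∣-refl) ⟩
    1ℤ                     ∎
    where open ≡-Reasoning

  [-x]^n≡-1^n*x^n : ∀ x n → (- x) ^ n ≡ -1ℤ ^ n * x ^ n
  [-x]^n≡-1^n*x^n x n = trans (cong (_^ n) (sym (-1*i≡-i x))) (^-distrib-* -1ℤ x n)

  -1^k*[-x]^[n∸k]≡x^[n∸k] : ∀ {n k} x → -1ℤ ^ n ≡ 1ℤ → k ℕ.≤ n →
                            -1ℤ ^ k * (- x) ^ (n ∸ k) ≡ x ^ (n ∸ k)
  -1^k*[-x]^[n∸k]≡x^[n∸k] {n} {k} x -1^n≡1 k≤n = begin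
    -1ℤ ^ k * (- x) ^ (n ∸ k)
      ≡⟨ cong (-1ℤ ^ k *_) ([-x]^n≡-1^n*x^n x (n ∸ k)) ⟩
    -1ℤ ^ k * (-1ℤ ^ (n ∸ k) * x ^ (n ∸ k))
      ≡⟨ *-assoc (-1ℤ ^ k) _ _ ⟨
    -1ℤ ^ k * -1ℤ ^ (n ∸ k) * x ^ (n ∸ k)
      ≡⟨ cong (_* x ^ (n ∸ k)) (^-homo-* -1ℤ k (n ∸ k)) ⟨
    -1ℤ ^ (k ℕ.+ (n ∸ k)) * x ^ (n ∸ k)
      ≡⟨ cong (λ e → -1ℤ ^ e * x ^ (n ∸ k)) (ℕ.m+[n∸m]≡n k≤n) ⟩
    -1ℤ ^ n * x ^ (n ∸ k)
      ≡⟨ cong (_* x ^ (n ∸ k)) -1^n≡1 ⟩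
    1ℤ * x ^ (n ∸ k)
      ≡⟨ *-identityˡ _ ⟩
    x ^ (n ∸ k)
      ∎
    where open ≡-Reasoning

  z^n≡∣z∣^n : ∀ n → -1ℤ ^ n ≡ 1ℤ → ∀ z → z ^ n ≡ (+ ∣ z ∣) ^ n
  z^n≡∣z∣^n n -1^n≡1 (+ m)    = refl
  z^n≡∣z∣^n n -1^n≡1 -[1+ m ] = begin
    (- +[1+ m ]) ^ n        ≡⟨ [-x]^n≡-1^n*x^n +[1+ m ] n ⟩
    -1ℤ ^ n * +[1+ m ] ^ n  ≡⟨ cong (_* +[1+ m ] ^ n) -1^n≡1 ⟩
    1ℤ * +[1+ m ] ^ n       ≡⟨ *-identityˡ _ ⟩
    +[1+ m ] ^ n            ∎
    where open ≡-Reasoning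

  fermatQuotientZero⇒^≡1 : ∀ {n m} → FermatQuotientZero (suc n) m →
                           (+ m) ^ n ≡ 1ℤ mod + suc n * + suc n
  fermatQuotientZero⇒^≡1 {n} {m} q≡0 = subst (_≡ 1ℤ mod _) (pos-^ m n) (≡1mod⇒≡1-mod q≡0)

  belowKappa-⊔ : ∀ {p u v} → BelowKappa p u → BelowKappa p v → BelowKappa p (u ⊔ v)
  belowKappa-⊔ {u = u} {v} κu κv with ℕ.⊔-sel u v
  ... | inj₁ u⊔v≡u rewrite u⊔v≡u = κu
  ... | inj₂ u⊔v≡v rewrite u⊔v≡v = κv

  z^p≡z-nonzero : ∀ {n m} z → 1 ℕ.≤ ∣ z ∣ → -1ℤ ^ n ≡ 1ℤ → BelowKappa (suc n) m →
                  ∣ z ∣ ℕ.≤ m → z ^ suc n ≡ z mod + suc n * + suc n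
  z^p≡z-nonzero {n} z 1≤∣z∣ -1^n≡1 κ ∣z∣≤m = begin
    z * z ^ n
      ≡⟨ cong (z *_) (z^n≡∣z∣^n n -1^n≡1 z) ⟩
    z * (+ ∣ z ∣) ^ n
      ≈⟨ *-congˡ-mod z (fermatQuotientZero⇒^≡1 {n} {∣ z ∣} (κ ∣ z ∣ 1≤∣z∣ ∣z∣≤m)) ⟩
    z * 1ℤ
      ≡⟨ *-identityʳ z ⟩
    z
      ∎
    where open ≡-mod-Reasoning (+ suc n * + suc n)

  belowKappa⇒z^p≡z : ∀ {n m} z → -1ℤ ^ n ≡ 1ℤ → BelowKappa (suc n) m → ∣ z ∣ ℕ.≤ m →
                     z ^ suc n ≡ z mod + suc n * + suc n
  belowKappa⇒z^p≡z {n} +0           _ _ _ = mod-reflexive (*-zeroˡ ((+ 0) ^ n))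
  belowKappa⇒z^p≡z {n} z@(+[1+ _ ]) = z^p≡z-nonzero {n} z (s≤s z≤n)
  belowKappa⇒z^p≡z {n} z@(-[1+ _ ]) = z^p≡z-nonzero {n} z (s≤s z≤n)

  -- Binomial coefficients modulo p and p²

  [p-1]Ck≡-1^k : ∀ {n} k → Prime (suc n) → k ℕ.≤ n → + (n C k) ≡ -1ℤ ^ k mod + suc n
  [p-1]Ck≡-1^k zero    _  _         = mod-refl
  [p-1]Ck≡-1^k {n} (suc k) pr k<n = begin
    + (n C suc k)
      ≡⟨ pascal-ℤ ⟩
    + (suc n C suc k) - + (n C k)
      ≈⟨ +-cong-mod pC[k+1]≡0 (-‿cong-mod ([p-1]Ck≡-1^k k pr (ℕ.<⇒≤ k<n))) ⟩
    0ℤ - -1ℤ ^ k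
      ≡⟨ +-identityˡ _ ⟩
    - (-1ℤ ^ k)
      ≡⟨ -1*i≡-i _ ⟨
    -1ℤ * -1ℤ ^ k
      ∎
    where
    open ≡-mod-Reasoning (+ suc n)
    pC[k+1]≡0 : + (suc n C suc k) ≡ 0ℤ mod + suc n
    pC[k+1]≡0 = ∣⇒≡0-mod (∣ᵤ⇒∣ {+ suc n} {+ (suc n C suc k)} (p∣pCk pr (s≤s z≤n) (s≤s k<n)))
    pascal-ℤ : + (n C suc k) ≡ + (suc n C suc k) - + (n C k)
    pascal-ℤ = trans (b≡a+b-a (+ (n C k)) (+ (n C suc k)))
      (cong (_- + (n C k)) (trans (sym (pos-+ (n C k) (n C suc k))) (cong +_ (pascal n k))))
      where
      b≡a+b-a : ∀ a b → b ≡ a + b - a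
      b≡a+b-a = solve-∀

  j*inv[j]≡1-mod : ∀ p inv → IsInverseModOn p inv →
                   ∀ {j} → 1 ℕ.≤ j → j ℕ.< p → + j * + inv j ≡ 1ℤ mod + p
  j*inv[j]≡1-mod p inv isInverse {j} 1≤j j<p =
    subst (_≡ 1ℤ mod + p) (pos-* j (inv j)) (≡1mod⇒≡1-mod {j ℕ.* inv j} {p} (isInverse j 1≤j j<p))

  pC[k+1]≡p*-1^k*i : ∀ {n k} i → Prime (suc n) → k ℕ.< n → + suc k * i ≡ 1ℤ mod + suc n →
                     + (suc n C suc k) ≡ + suc n * (-1ℤ ^ k * i) mod + suc n * + suc n
  pC[k+1]≡p*-1^k*i {n} {k} i pr k<n [k+1]i≡1 with p∣pCk pr (s≤s z≤n) (s≤s k<n)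
  ... | ℕ.divides c pC[k+1]≡c*p =
    mod-trans (mod-reflexive pC[k+1]≡p*c) (*-scale-mod (+ suc n) c≡-1^k*i)
    where
    pC[k+1]≡p*c : + (suc n C suc k) ≡ + suc n * + c
    pC[k+1]≡p*c = trans (cong +_ pC[k+1]≡c*p) (trans (pos-* c (suc n)) (*-comm (+ c) (+ suc n)))

    [k+1]c≡[p-1]Ck : suc k ℕ.* c ≡ n C k
    [k+1]c≡[p-1]Ck = ℕ.*-cancelʳ-≡ (suc k ℕ.* c) (n C k) (suc n) (begin
      suc k ℕ.* c ℕ.* suc n      ≡⟨ ℕ.*-assoc (suc k) c (suc n) ⟩
      suc k ℕ.* (c ℕ.* suc n)    ≡⟨ cong (suc k ℕ.*_) pC[k+1]≡c*p ⟨
      suc k ℕ.* (suc n C suc k)  ≡⟨ [k+1]*[n+1]C[k+1]≡[n+1]*nCk n k ⟩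
      suc n ℕ.* (n C k)          ≡⟨ ℕ.*-comm (suc n) (n C k) ⟩
      (n C k) ℕ.* suc n          ∎)
      where open ≡-Reasoning

    c≡-1^k*i : + c ≡ -1ℤ ^ k * i mod + suc n
    c≡-1^k*i = begin
      + c                  ≡⟨ *-identityˡ (+ c) ⟨
      1ℤ * + c             ≈⟨ *-congʳ-mod (+ c) (mod-sym [k+1]i≡1) ⟩
      + suc k * i * + c    ≡⟨ ai*c≡i*ac (+ suc k) i (+ c) ⟩
      i * (+ suc k * + c)  ≡⟨ cong (i *_) (trans (sym (pos-* (suc k) c)) (cong +_ [k+1]c≡[p-1]Ck)) ⟩
      i * + (n C k)        ≈⟨ *-congˡ-mod i ([p-1]Ck≡-1^k k pr (ℕ.<⇒≤ k<n)) ⟩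
      i * -1ℤ ^ k          ≡⟨ *-comm i (-1ℤ ^ k) ⟩
      -1ℤ ^ k * i          ∎
      where
      open ≡-mod-Reasoning (+ suc n)
      ai*c≡i*ac : ∀ a i c → a * i * c ≡ i * (a * c)
      ai*c≡i*ac = solve-∀

  -- The Mirimanoff sum

  -- y^p γ_p(x/y) = Σ_{j=1}^{p-1} x^j y^(p-j) / j, written with p = n + 1, j = k + 1 and 1/j = inv j.
  homogenisedMirimanoff : ℕ → (ℕ → ℕ) → ℤ → ℤ → ℤ
  homogenisedMirimanoff n inv x y =
    ∑[ k < n ] (+ inv (suc (toℕ k)) * (x ^ suc (toℕ k) * y ^ (n ∸ toℕ k)))

  binomial-inner≡0 : ∀ {n m} x y → -1ℤ ^ n ≡ 1ℤ → BelowKappa (suc n) m →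
    ∣ x ∣ ℕ.≤ m → ∣ y ∣ ℕ.≤ m → ∣ x - y ∣ ℕ.≤ m →
    ∑[ k < n ] (+ (suc n C suc (toℕ k)) * (x ^ suc (toℕ k) * (- y) ^ (n ∸ toℕ k)))
      ≡ 0ℤ mod + suc n * + suc n
  binomial-inner≡0 {n} {m} x y -1^n≡1 κ ∣x∣≤m ∣y∣≤m ∣x-y∣≤m = begin
    inner
      ≡⟨ c≡b+c+d-b-d ((- y) ^ suc n) inner (x ^ suc n) ⟩
    (- y) ^ suc n + inner + x ^ suc n - (- y) ^ suc n - x ^ suc n
      ≡⟨ cong (λ e → e - (- y) ^ suc n - x ^ suc n) (binomial-theorem-inner x (- y) n) ⟨
    (x - y) ^ suc n - (- y) ^ suc n - x ^ suc n
      ≈⟨ +-cong-mod (+-cong-mod (fermat (x - y) ∣x-y∣≤m) (-‿cong-mod (fermat (- y) ∣-y∣≤m)))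
                    (-‿cong-mod (fermat x ∣x∣≤m)) ⟩
    x - y - - y - x
      ≡⟨ x-y+y-x≡0 x y ⟩
    0ℤ
      ∎
    where
    open ≡-mod-Reasoning (+ suc n * + suc n)
    inner : ℤ
    inner = ∑[ k < n ] (+ (suc n C suc (toℕ k)) * (x ^ suc (toℕ k) * (- y) ^ (n ∸ toℕ k)))
    fermat : ∀ z → ∣ z ∣ ℕ.≤ m → z ^ suc n ≡ z mod + suc n * + suc n
    fermat z = belowKappa⇒z^p≡z {n} z -1^n≡1 κ
    ∣-y∣≤m : ∣ - y ∣ ℕ.≤ m
    ∣-y∣≤m = subst (ℕ._≤ m) (sym (∣-i∣≡∣i∣ y)) ∣y∣≤m
    c≡b+c+d-b-d : ∀ b c d → c ≡ b + c + d - b - d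
    c≡b+c+d-b-d = solve-∀
    x-y+y-x≡0 : ∀ x y → x - y - - y - x ≡ 0ℤ
    x-y+y-x≡0 = solve-∀

  binomial-term≡p*mirimanoff-term : ∀ {n k} i x y → Prime (suc n) → -1ℤ ^ n ≡ 1ℤ → k ℕ.< n →
    + suc k * i ≡ 1ℤ mod + suc n →
    + (suc n C suc k) * (x ^ suc k * (- y) ^ (n ∸ k))
      ≡ + suc n * (i * (x ^ suc k * y ^ (n ∸ k))) mod + suc n * + suc n
  binomial-term≡p*mirimanoff-term {n} {k} i x y pr -1^n≡1 k<n [k+1]i≡1 = begin
    + (suc n C suc k) * (x ^ suc k * (- y) ^ (n ∸ k))
      ≈⟨ *-congʳ-mod (x ^ suc k * (- y) ^ (n ∸ k)) (pC[k+1]≡p*-1^k*i i pr k<n [k+1]i≡1) ⟩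
    + suc n * (-1ℤ ^ k * i) * (x ^ suc k * (- y) ^ (n ∸ k))
      ≡⟨ regroup (+ suc n) (-1ℤ ^ k) i (x ^ suc k) ((- y) ^ (n ∸ k)) ⟩
    + suc n * (i * (x ^ suc k * (-1ℤ ^ k * (- y) ^ (n ∸ k))))
      ≡⟨ cong (λ e → + suc n * (i * (x ^ suc k * e)))
              (-1^k*[-x]^[n∸k]≡x^[n∸k] y -1^n≡1 (ℕ.<⇒≤ k<n)) ⟩
    + suc n * (i * (x ^ suc k * y ^ (n ∸ k)))
      ∎
    where
    open ≡-mod-Reasoning (+ suc n * + suc n)
    regroup : ∀ p s i a b → p * (s * i) * (a * b) ≡ p * (i * (a * (s * b)))
    regroup = solve-∀

  homogenisedMirimanoff≡0 : ∀ {n m} inv x y → Prime (suc n) → -1ℤ ^ n ≡ 1ℤ →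
    IsInverseModOn (suc n) inv → BelowKappa (suc n) m →
    ∣ x ∣ ℕ.≤ m → ∣ y ∣ ℕ.≤ m → ∣ x - y ∣ ℕ.≤ m →
    homogenisedMirimanoff n inv x y ≡ 0ℤ mod + suc n
  homogenisedMirimanoff≡0 {n} inv x y pr -1^n≡1 isInverse κ ∣x∣≤m ∣y∣≤m ∣x-y∣≤m =
    *-unscale-mod (+ suc n) (begin
      + suc n * homogenisedMirimanoff n inv x y
        ≡⟨ *-distribˡ-sum {n} (+ suc n) (λ k → mirimanoff-term (toℕ k)) ⟩
      ∑[ k < n ] (+ suc n * mirimanoff-term (toℕ k))
        ≈⟨ mod-sym (∑-cong-mod (λ k → term≡ (toℕ<n k))) ⟩
      ∑[ k < n ] (+ (suc n C suc (toℕ k)) * (x ^ suc (toℕ k) * (- y) ^ (n ∸ toℕ k)))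
        ≈⟨ binomial-inner≡0 {n} x y -1^n≡1 κ ∣x∣≤m ∣y∣≤m ∣x-y∣≤m ⟩
      0ℤ
        ≡⟨ *-zeroʳ (+ suc n) ⟨
      + suc n * 0ℤ
        ∎)
    where
    open ≡-mod-Reasoning (+ suc n * + suc n)
    mirimanoff-term : ℕ → ℤ
    mirimanoff-term k = + inv (suc k) * (x ^ suc k * y ^ (n ∸ k))
    term≡ : ∀ {k} → k ℕ.< n → + (suc n C suc k) * (x ^ suc k * (- y) ^ (n ∸ k))
                              ≡ + suc n * mirimanoff-term k mod + suc n * + suc n
    term≡ k<n = binomial-term≡p*mirimanoff-term _ x y pr -1^n≡1 k<n
      (j*inv[j]≡1-mod (suc n) inv isInverse (s≤s z≤n) (s≤s k<n))

  w^p*homogenisedMirimanoff≡ : ∀ {m} n inv x y w → y * w ≡ 1ℤ mod m →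
    w ^ suc n * homogenisedMirimanoff n inv x y
      ≡ ∑[ k < n ] ((x * w) ^ suc (toℕ k) * + inv (suc (toℕ k))) mod m
  w^p*homogenisedMirimanoff≡ {m} n inv x y w yw≡1 = begin
    w ^ suc n * homogenisedMirimanoff n inv x y
      ≡⟨ *-distribˡ-sum {n} (w ^ suc n) (λ k → mirimanoff-term (toℕ k)) ⟩
    ∑[ k < n ] (w ^ suc n * mirimanoff-term (toℕ k))
      ≈⟨ ∑-cong-mod (λ k → term≡ (toℕ k) (ℕ.<⇒≤ (toℕ<n k))) ⟩
    ∑[ k < n ] ((x * w) ^ suc (toℕ k) * + inv (suc (toℕ k)))
      ∎
    where
    open ≡-mod-Reasoning m
    mirimanoff-term : ℕ → ℤ
    mirimanoff-term k = + inv (suc k) * (x ^ suc k * y ^ (n ∸ k))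
    term≡ : ∀ k → k ℕ.≤ n → w ^ suc n * mirimanoff-term k ≡ (x * w) ^ suc k * + inv (suc k) mod m
    term≡ k k≤n = begin
      w ^ suc n * (i * (x ^ suc k * y ^ (n ∸ k)))
        ≡⟨ cong (λ e → w ^ e * (i * (x ^ suc k * y ^ (n ∸ k)))) (ℕ.m+[n∸m]≡n (s≤s k≤n)) ⟨
      w ^ (suc k ℕ.+ (n ∸ k)) * (i * (x ^ suc k * y ^ (n ∸ k)))
        ≡⟨ cong (_* (i * (x ^ suc k * y ^ (n ∸ k)))) (^-homo-* w (suc k) (n ∸ k)) ⟩
      w ^ suc k * w ^ (n ∸ k) * (i * (x ^ suc k * y ^ (n ∸ k)))
        ≡⟨ regroup (w ^ suc k) (w ^ (n ∸ k)) i (x ^ suc k) (y ^ (n ∸ k)) ⟩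
      i * ((x ^ suc k * w ^ suc k) * (y ^ (n ∸ k) * w ^ (n ∸ k)))
        ≡⟨ cong₂ (λ a b → i * (a * b)) (^-distrib-* x w (suc k)) (^-distrib-* y w (n ∸ k)) ⟨
      i * ((x * w) ^ suc k * (y * w) ^ (n ∸ k))
        ≈⟨ *-congˡ-mod i (*-congˡ-mod ((x * w) ^ suc k) (^≡1-mod yw≡1 (n ∸ k))) ⟩
      i * ((x * w) ^ suc k * 1ℤ)
        ≡⟨ i[a*1]≡a*i i ((x * w) ^ suc k) ⟩
      (x * w) ^ suc k * i
        ∎
      where
      i : ℤ
      i = + inv (suc k)
      regroup : ∀ a b i c d → a * b * (i * (c * d)) ≡ i * ((c * a) * (d * b))
      regroup = solve-∀
      i[a*1]≡a*i : ∀ i a → i * (a * 1ℤ) ≡ a * i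
      i[a*1]≡a*i = solve-∀

  +mirimanoff : ∀ n inv t →
    + mirimanoff (suc n) inv t ≡ ∑[ k < n ] ((+ t) ^ suc (toℕ k) * + inv (suc (toℕ k)))
  +mirimanoff n inv t = trans (+sumFrom1 n (λ j → t ℕ.^ j ℕ.* inv j))
    (sum-cong-≗ {n} (λ k → trans (pos-* (t ℕ.^ suc (toℕ k)) (inv (suc (toℕ k))))
                                  (cong (_* + inv (suc (toℕ k))) (pos-^ t (suc (toℕ k))))))

  mirimanoff≡0 : ∀ n inv u v w → Prime (suc n) → ¬ (2 ℕ.∣ suc n) → IsInverseModOn (suc n) inv →
    BelowKappa (suc n) u → BelowKappa (suc n) v → ≡1mod (v ℕ.* w) (suc n) →
    + mirimanoff (suc n) inv (u ℕ.* w) ≡ 0ℤ mod + suc n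
  mirimanoff≡0 n inv u v w pr 2∤p isInverse κu κv vw≡1 = begin
    + mirimanoff (suc n) inv (u ℕ.* w)
      ≡⟨ +mirimanoff n inv (u ℕ.* w) ⟩
    ∑[ k < n ] ((+ (u ℕ.* w)) ^ suc (toℕ k) * + inv (suc (toℕ k)))
      ≡⟨ cong (λ t → ∑[ k < n ] (t ^ suc (toℕ k) * + inv (suc (toℕ k)))) (pos-* u w) ⟩
    ∑[ k < n ] ((+ u * + w) ^ suc (toℕ k) * + inv (suc (toℕ k)))
      ≈⟨ w^p*homogenisedMirimanoff≡ n inv (+ u) (+ v) (+ w) vw≡1-ℤ ⟨
    (+ w) ^ suc n * homogenisedMirimanoff n inv (+ u) (+ v)
      ≈⟨ *-congˡ-mod ((+ w) ^ suc n) p∣H ⟩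
    (+ w) ^ suc n * 0ℤ
      ≡⟨ *-zeroʳ ((+ w) ^ suc n) ⟩
    0ℤ
      ∎
    where
    open ≡-mod-Reasoning (+ suc n)
    vw≡1-ℤ : + v * + w ≡ 1ℤ mod + suc n
    vw≡1-ℤ = subst (_≡ 1ℤ mod + suc n) (pos-* v w) (≡1mod⇒≡1-mod {v ℕ.* w} {suc n} vw≡1)
    ∣u-v∣≤u⊔v : ∣ + u - + v ∣ ℕ.≤ u ⊔ v
    ∣u-v∣≤u⊔v = subst (ℕ._≤ u ⊔ v) (cong ∣_∣ (sym (m-n≡m⊖n u v))) (∣m⊝n∣≤m⊔n u v)
    p∣H : homogenisedMirimanoff n inv (+ u) (+ v) ≡ 0ℤ mod + suc n
    p∣H = homogenisedMirimanoff≡0 {n} inv (+ u) (+ v) pr (2∤1+n⇒-1^n≡1 n 2∤p) isInverse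
            (belowKappa-⊔ {suc n} {u} {v} κu κv) (ℕ.m≤m⊔n u v) (ℕ.m≤n⊔m u v) ∣u-v∣≤u⊔v

open import Data.Nat using (ℕ; zero; suc; _*_; _≤_)
open import Data.Nat.Primality using (Prime)
open import Data.Nat.Divisibility using (_∣_; _∣0)
open import Data.Integer.Divisibility.Signed using (∣⇒∣ᵤ)
open import Relation.Nullary using (¬_; contradiction)

proposition3 : (p : ℕ) → Prime p → ¬ (2 ∣ p) →
    (inv : ℕ → ℕ) → IsInverseModOn p inv →
    (u v : ℕ) → 1 ≤ u → 1 ≤ v → BelowKappa p u → BelowKappa p v →
    (w : ℕ) → ≡1mod (v * w) p →
    p ∣ mirimanoff p inv (u * w)
proposition3 zero    _  2∤0 _   _         _ _ _ _ _  _  _ _     = contradiction (2 ∣0) 2∤0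
proposition3 (suc n) pr 2∤p inv isInverse u v _ _ κu κv w vw≡1 =
  ∣⇒∣ᵤ (≡0-mod⇒∣ (mirimanoff≡0 n inv u v w pr 2∤p isInverse κu κv vw≡1))
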